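{- No deficient positive integer is ample. That is, if $n$ is a positive integer with $\sigma(n) - n < n$, then $a(n) \leq n$.
   Context: $\sigma(n)$ denotes the sum of all positive divisors of $n$. A positive integer $n$ is deficient if $\sigma(n) - n < n$. For positive integers, write $m \lfloor n$ to mean that $m$ is a proper divisor of $n$. The number of recursive divisors is defined by $a(1)=1$ and $a(n) = 1 + \sum_{m \lfloor n} a(m)$ for $n>1$. A positive integer $n$ is ample if $a(n) > n$. -}

module Defs where

open import Data.Nat using (ℕ; zero; suc; _+_; _<_; _≤_)
open import Data.Nat.Divisibility using (_∣_; _∣?_)
open import Data.List using (List; filter; map)
open import Data.List.Base using (applyUpTo)
open import Data.Nat.ListAction using (sum)

properDivisors : ℕ → List ℕ
properDivisors n = filter (λ m → m ∣? n) (applyUpTo suc (n Data.Nat.∸ 1))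

σ : ℕ → ℕ
σ n = sum (properDivisors n) + n

Deficient : ℕ → Set
Deficient n = σ n Data.Nat.∸ n < n

-- recursive divisor count with fuel (fuel ≥ n suffices, since proper divisors are < n)
aFuel : ℕ → ℕ → ℕ
aFuel zero    n = 1
aFuel (suc k) n = 1 + sum (map (aFuel k) (properDivisors n))

-- a(1) = 1 and a(n) = 1 + Σ_{m proper divisor of n} a(m)
a : ℕ → ℕ
a n = aFuel n n

Ample : ℕ → Set
Ample n = n < a n

{-# OPTIONS --safe #-}
-- Deficiency is inherited by divisors: if n = q·d, then every divisor c of d gives the
-- divisor q·c of n, so q·σ(d) ≤ σ(n), and σ(n) < 2n = q·2d forces σ(d) < 2d.  Hence all
-- proper divisors of a deficient n are deficient, and by induction a(m) ≤ m for each of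
-- them, which gives a(n) ≤ 1 + Σ_{m proper divisor of n} m ≤ n.
module Submission where

open import Defs
open import Data.Nat using (ℕ; _<_; _≤_)
open import Relation.Nullary using (¬_)

open import Data.Nat using (zero; suc; _+_; _*_; _∸_; z≤n; s≤s; _≤′_; ≤′-refl; ≤′-step)
open import Data.Nat.Properties
open import Data.Nat.Divisibility using (_∣_; _∣?_; divides; *-monoˡ-∣; ∣-refl)
open import Data.List using ([]; _∷_; filter; map; [_]; _++_)
open import Data.List.Base using (applyUpTo)
open import Data.List.Properties using (applyUpTo-∷ʳ; filter-++)
open import Data.Nat.ListAction using (sum)
open import Data.Nat.ListAction.Properties using (sum-++)
open import Data.List.Membership.Propositional using (_∈_)
open import Data.List.Membership.Propositional.Properties using (∈-filter⁻; ∈-applyUpTo⁻)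
open import Data.List.Relation.Unary.Any using (here; there)
open import Data.Bool using (true; false)
open import Data.Empty using (⊥-elim)
open import Data.Product using (_,_; _×_)
open import Function using (_∘_)
open import Relation.Nullary using (yes; no; does)
open import Relation.Binary.PropositionalEquality
  using (_≡_; refl; sym; trans; cong; cong₂; subst; module ≡-Reasoning)

divisorSumUpTo : ℕ → ℕ → ℕ
divisorSumUpTo n b = sum (filter (_∣? n) (applyUpTo suc b))

divisorTerm : ℕ → ℕ → ℕ
divisorTerm n m with does (m ∣? n)
... | true  = m
... | false = 0

divisorSumUpTo-suc : ∀ n b → divisorSumUpTo n (suc b) ≡ divisorSumUpTo n b + divisorTerm n (suc b)
divisorSumUpTo-suc n b = begin
  sum (filter (_∣? n) (applyUpTo suc (suc b)))
    ≡⟨ cong (λ ms → sum (filter (_∣? n) ms)) (sym (applyUpTo-∷ʳ suc b)) ⟩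
  sum (filter (_∣? n) (applyUpTo suc b ++ [ suc b ]))
    ≡⟨ cong sum (filter-++ (_∣? n) (applyUpTo suc b) [ suc b ]) ⟩
  sum (filter (_∣? n) (applyUpTo suc b) ++ filter (_∣? n) [ suc b ])
    ≡⟨ sum-++ (filter (_∣? n) (applyUpTo suc b)) _ ⟩
  divisorSumUpTo n b + sum (filter (_∣? n) [ suc b ])
    ≡⟨ cong (divisorSumUpTo n b +_) last ⟩
  divisorSumUpTo n b + divisorTerm n (suc b) ∎
  where
  open ≡-Reasoning
  last : sum (filter (_∣? n) [ suc b ]) ≡ divisorTerm n (suc b)
  last with does (suc b ∣? n)
  ... | true  = +-identityʳ (suc b)
  ... | false = refl

divisorSumUpTo-mono′ : ∀ n {b c} → b ≤′ c → divisorSumUpTo n b ≤ divisorSumUpTo n c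
divisorSumUpTo-mono′ n ≤′-refl = ≤-refl
divisorSumUpTo-mono′ n {b} (≤′-step {c} b≤c) = begin
  divisorSumUpTo n b                              ≤⟨ divisorSumUpTo-mono′ n b≤c ⟩
  divisorSumUpTo n c                              ≤⟨ m≤m+n _ _ ⟩
  divisorSumUpTo n c + divisorTerm n (suc c)      ≡⟨ divisorSumUpTo-suc n c ⟨
  divisorSumUpTo n (suc c)                        ∎
  where open ≤-Reasoning

divisorSumUpTo-mono : ∀ n {b c} → b ≤ c → divisorSumUpTo n b ≤ divisorSumUpTo n c
divisorSumUpTo-mono n b≤c = divisorSumUpTo-mono′ n (≤⇒≤′ b≤c)

divisorTerm-* : ∀ d q c → q * divisorTerm d c ≤ divisorTerm (d * q) (c * q)
divisorTerm-* d q c with c ∣? d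
... | no _ = ≤-trans (≤-reflexive (*-zeroʳ q)) z≤n
... | yes c∣d with c * q ∣? d * q
...   | yes _   = ≤-reflexive (*-comm q c)
...   | no cq∤dq = ⊥-elim (cq∤dq (*-monoˡ-∣ q c∣d))

divisorSumUpTo-* : ∀ d q b → suc q * divisorSumUpTo d b ≤ divisorSumUpTo (d * suc q) (b * suc q)
divisorSumUpTo-* d q zero = ≤-reflexive (*-zeroʳ (suc q))
divisorSumUpTo-* d q (suc b) = begin
  suc q * divisorSumUpTo d (suc b)
    ≡⟨ cong (suc q *_) (divisorSumUpTo-suc d b) ⟩
  suc q * (divisorSumUpTo d b + divisorTerm d (suc b))
    ≡⟨ *-distribˡ-+ (suc q) (divisorSumUpTo d b) _ ⟩
  suc q * divisorSumUpTo d b + suc q * divisorTerm d (suc b)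
    ≤⟨ +-mono-≤ (≤-trans (divisorSumUpTo-* d q b) (divisorSumUpTo-mono n (m≤n+m _ q)))
                (divisorTerm-* d (suc q) (suc b)) ⟩
  divisorSumUpTo n (q + b * suc q) + divisorTerm n (suc b * suc q)
    ≡⟨ divisorSumUpTo-suc n (q + b * suc q) ⟨
  divisorSumUpTo n (suc b * suc q) ∎
  where
  open ≤-Reasoning
  n = d * suc q

divisorTerm-self : ∀ n → divisorTerm n n ≡ n
divisorTerm-self n with n ∣? n
... | yes _   = refl
... | no n∤n = ⊥-elim (n∤n ∣-refl)

σ≡divisorSumUpTo : ∀ m → σ (suc m) ≡ divisorSumUpTo (suc m) (suc m)
σ≡divisorSumUpTo m = sym (begin
  divisorSumUpTo (suc m) (suc m)
    ≡⟨ divisorSumUpTo-suc (suc m) m ⟩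
  divisorSumUpTo (suc m) m + divisorTerm (suc m) (suc m)
    ≡⟨ cong (divisorSumUpTo (suc m) m +_) (divisorTerm-self (suc m)) ⟩
  σ (suc m) ∎)
  where open ≡-Reasoning

σ-* : ∀ d q → suc q * σ (suc d) ≤ σ (suc d * suc q)
σ-* d q = begin
  suc q * σ (suc d)                                  ≡⟨ cong (suc q *_) (σ≡divisorSumUpTo d) ⟩
  suc q * divisorSumUpTo (suc d) (suc d)             ≤⟨ divisorSumUpTo-* (suc d) q (suc d) ⟩
  divisorSumUpTo (suc d * suc q) (suc d * suc q)     ≡⟨ σ≡divisorSumUpTo (q + d * suc q) ⟨
  σ (suc d * suc q)                                  ∎
  where open ≤-Reasoning

Deficient⇒properDivisorSum< : ∀ {n} → Deficient n → sum (properDivisors n) < n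
Deficient⇒properDivisorSum< {n} = subst (_< n) (m+n∸n≡m (sum (properDivisors n)) n)

Deficient⇒σ< : ∀ {n} → Deficient n → σ n < n + n
Deficient⇒σ< {n} def = +-monoˡ-< n (Deficient⇒properDivisorSum< def)

σ<⇒Deficient : ∀ {n} → σ n < n + n → Deficient n
σ<⇒Deficient {n} σ<2n =
  subst (_< n) (sym (m+n∸n≡m (sum (properDivisors n)) n)) (+-cancelʳ-< n _ n σ<2n)

Deficient-* : ∀ d q → Deficient (d * suc q) → Deficient d
Deficient-* zero q ()
Deficient-* (suc d) q def = σ<⇒Deficient (*-cancelˡ-< (suc q) _ _ (begin-strict
  suc q * σ (suc d)                              ≤⟨ σ-* d q ⟩
  σ n                                            <⟨ Deficient⇒σ< def ⟩
  n + n                                          ≡⟨ cong₂ _+_ (*-comm (suc d) (suc q)) (*-comm (suc d) (suc q)) ⟩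
  suc q * suc d + suc q * suc d                  ≡⟨ *-distribˡ-+ (suc q) (suc d) (suc d) ⟨
  suc q * (suc d + suc d)                        ∎))
  where
  open ≤-Reasoning
  n = suc d * suc q

Deficient-∣ : ∀ {m n} → 0 < n → m ∣ n → Deficient n → Deficient m
Deficient-∣ {n = n} 0<n (divides zero n≡0) _ = ⊥-elim (<⇒≢ 0<n (sym n≡0))
Deficient-∣ {m} _ (divides (suc q) n≡qm) def =
  Deficient-* m q (subst Deficient (trans n≡qm (*-comm (suc q) m)) def)

∈-properDivisors⁻ : ∀ {m n} → m ∈ properDivisors n → 0 < m × m ∣ n
∈-properDivisors⁻ {n = n} m∈ with ∈-filter⁻ (_∣? n) {xs = applyUpTo suc (n ∸ 1)} m∈
... | m∈range , m∣n with ∈-applyUpTo⁻ suc {n = n ∸ 1} m∈range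
...   | i , _ , refl = s≤s z≤n , m∣n

sum-map-≤ : ∀ (f : ℕ → ℕ) xs → (∀ {x} → x ∈ xs → f x ≤ x) → sum (map f xs) ≤ sum xs
sum-map-≤ f []       _    = z≤n
sum-map-≤ f (x ∷ xs) f≤id = +-mono-≤ (f≤id (here refl)) (sum-map-≤ f xs (f≤id ∘ there))

aFuel-≤ : ∀ k n → 0 < n → Deficient n → aFuel k n ≤ n
aFuel-≤ zero    n 0<n _   = 0<n
aFuel-≤ (suc k) n 0<n def = begin
  suc (sum (map (aFuel k) (properDivisors n)))  ≤⟨ s≤s (sum-map-≤ (aFuel k) _ a≤id) ⟩
  suc (sum (properDivisors n))                  ≤⟨ Deficient⇒properDivisorSum< def ⟩
  n                                             ∎
  where
  open ≤-Reasoning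
  a≤id : ∀ {m} → m ∈ properDivisors n → aFuel k m ≤ m
  a≤id m∈ with ∈-properDivisors⁻ m∈
  ... | 0<m , m∣n = aFuel-≤ k _ 0<m (Deficient-∣ 0<n m∣n def)

lemma1 : (n : ℕ) → 0 < n → Deficient n → ¬ Ample n
lemma1 n 0<n def = ≤⇒≯ (aFuel-≤ n n 0<n def)
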